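{- Let $n\ge 2$ be an integer and let $T=(a_1,\ldots,a_k)$ be a tuple of integers with $k\ge 1$ and $1\le a_1<a_2<\cdots<a_k<n$. Put $g_T(x)=p_n(x)+\sum_{i=1}^{k}p_{a_i}(x)$. Then: (1) $g_T(x)=p_{a_1}(x)\,h_T(x)$ for some $h_T\in\mathbb{Z}[x]$ with $\deg h_T=n-a_1$; (2) the roots $x=-i$, $i=0,1,\ldots,a_1$, of $g_T$ are simple; in particular $g_T$ has at least two roots of odd multiplicity; (3) if $n\ge 5$, $k\ge 3$, $a_1=1$, $a_2=3$ and $a_3\ge 5$, then $h_T(x)$ is not the square of a polynomial with integer coefficients; in particular $g_T$ has at least three (complex) roots of odd multiplicity; (4) the equation $g_T(x)=\pm 1$ has no solutions $x\in\mathbb{Z}$.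
   Context: For a non-negative integer $a$, $p_a(x)=\prod_{i=0}^{a}(x+i)$, a monic polynomial of degree $a+1$. -}

module Defs where

open import Data.Nat using (ℕ; zero; suc)
open import Data.Integer using (ℤ; +_; _+_; _*_; -_; 0ℤ; 1ℤ)
open import Data.List using (List; []; _∷_; map; foldr)
open import Data.Product using (∃; _×_)
open import Relation.Binary.PropositionalEquality using (_≡_)
open import Relation.Nullary using (¬_)

-- Polynomials in ℤ[x] as coefficient lists, lowest degree first.
-- Trailing zeros are allowed; equality is coefficientwise (_≈P_).
Poly : Set
Poly = List ℤ

coeff : Poly → ℕ → ℤ
coeff []      _       = 0ℤ
coeff (c ∷ p) zero    = c
coeff (c ∷ p) (suc i) = coeff p i

_≈P_ : Poly → Poly → Set
p ≈P q = ∀ i → coeff p i ≡ coeff q i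

infixl 6 _+P_
infixl 7 _*P_

_+P_ : Poly → Poly → Poly
[]      +P q       = q
(a ∷ p) +P []      = a ∷ p
(a ∷ p) +P (b ∷ q) = (a + b) ∷ (p +P q)

scaleP : ℤ → Poly → Poly
scaleP c p = map (c *_) p

_*P_ : Poly → Poly → Poly
[]      *P q = []
(a ∷ p) *P q = scaleP a q +P (0ℤ ∷ (p *P q))

sumP : List Poly → Poly
sumP = foldr _+P_ []

eval : Poly → ℤ → ℤ
eval p x = foldr (λ c acc → c + x * acc) 0ℤ p

HasDegree : Poly → ℕ → Set
HasDegree p d = (¬ coeff p d ≡ 0ℤ) × (∀ i → d Data.Nat.< i → coeff p i ≡ 0ℤ)
  where import Data.Nat

_∣P_ : Poly → Poly → Set
d ∣P g = ∃ λ q → g ≈P (d *P q)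

xMinus : ℤ → Poly
xMinus r = (- r) ∷ 1ℤ ∷ []

SimpleRoot : ℤ → Poly → Set
SimpleRoot r g = (xMinus r ∣P g) × ¬ ((xMinus r *P xMinus r) ∣P g)

IsSquare : Poly → Set
IsSquare h = ∃ λ q → h ≈P (q *P q)

-- p_a(x) = ∏_{i=0}^{a} (x + i)
pP : ℕ → Poly
pP zero    = 0ℤ ∷ 1ℤ ∷ []
pP (suc a) = pP a *P ((+ suc a) ∷ 1ℤ ∷ [])

gT : ℕ → List ℕ → Poly
gT n T = pP n +P sumP (map pP T)

{-# OPTIONS --safe #-}
module Submission where

-- With a = a₁, h_T = g_T / p_a = 1 + p_n/p_a + Σ_{i ≥ 2} p_{aᵢ}/p_a, where
-- p_b/p_a = (x + a + 1) ⋯ (x + b); the term p_n/p_a makes h_T monic of degree n − a.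
-- At x = −i with i ≤ a each quotient is a nonnegative integer, so h_T(−i) ≥ 1 and the
-- simple root −i of p_a stays simple in g_T = p_a h_T, as the formal derivative detects.
-- For T = (1, 3, …) every quotient except (x + 2)(x + 3) vanishes at −4, so h_T(−4) = 3,
-- which is not a square. Finally x(x + 1) divides p_a, so g_T(x) is even and never ±1.

open import Defs
open import Data.Nat using (ℕ; _≤_; _<_; _∸_)
open import Data.Integer using (ℤ; +_; -_; 1ℤ)
open import Data.List using (List; _∷_)
open import Data.List.Relation.Unary.All using (All)
open import Data.List.Relation.Unary.Linked using (Linked)
open import Data.Product using (Σ; _×_)
open import Relation.Binary.PropositionalEquality using (_≡_)
open import Relation.Nullary using (¬_)

open import Algebra.Properties.CommutativeSemigroup using (interchange; x∙yz≈y∙xz)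
open import Data.Integer.Base as ℤ using (0ℤ; _+_; _*_; -[1+_])
import Data.Integer.Properties as ℤ
open import Data.Integer.Divisibility.Signed using (_∣_; ∣m⇒∣m*n; ∣ᵤ⇒∣; ∣⇒∣ᵤ)
open import Data.Integer.Tactic.RingSolver using (solve-∀)
open import Data.List.Base using ([]; map)
open import Data.List.Relation.Unary.All using ([]; _∷_)
import Data.List.Relation.Unary.All as All
import Data.List.Relation.Unary.All.Properties as All
open import Data.List.Relation.Unary.AllPairs using (_∷_)
open import Data.List.Relation.Unary.Linked using (_∷_)
open import Data.List.Relation.Unary.Linked.Properties using (Linked⇒AllPairs)
open import Data.Nat.Base as ℕ using (zero; suc; z≤n; s≤s)
import Data.Nat.Divisibility as ℕ
import Data.Nat.Properties as ℕ
import Data.Nat.Tactic.RingSolver as ℕ-Solver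
open import Data.Product using (∃-syntax; _,_; proj₁; proj₂)
open import Data.Sum using (inj₁; inj₂; [_,_]′)
open import Function.Base using (_∘_; case_of_)
open import Relation.Binary.Bundles using (Setoid)
open import Relation.Binary.Structures using (IsEquivalence)
open import Relation.Binary.PropositionalEquality
  using (_≢_; refl; sym; trans; cong; cong₂; subst; subst₂; module ≡-Reasoning)
import Relation.Binary.Reasoning.Setoid as SetoidReasoning
open import Relation.Nullary using (contradiction)

-- Coefficientwise equality and the semiring laws of ℤ[x]

-- A record around _≈P_, so that the two polynomials can be inferred from a proof.
infix 4 _≋_
record _≋_ (p q : Poly) : Set where
  constructor coeffwise
  field coeff-≡ : p ≈P q
open _≋_

≋-isEquivalence : IsEquivalence _≋_
≋-isEquivalence = record
  { refl  = coeffwise λ _ → refl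
  ; sym   = λ p≋q → coeffwise λ i → sym (coeff-≡ p≋q i)
  ; trans = λ p≋q q≋r → coeffwise λ i → trans (coeff-≡ p≋q i) (coeff-≡ q≋r i)
  }

≋-setoid : Setoid _ _
≋-setoid = record { Carrier = Poly ; _≈_ = _≋_ ; isEquivalence = ≋-isEquivalence }

open IsEquivalence ≋-isEquivalence
  using () renaming (refl to ≋-refl; sym to ≋-sym; trans to ≋-trans)

module ≋-Reasoning = SetoidReasoning ≋-setoid

≋-by-coeff : ∀ {p q} {f g : ℕ → ℤ} →
  (∀ i → coeff p i ≡ f i) → (∀ i → coeff q i ≡ g i) → (∀ i → f i ≡ g i) → p ≋ q
≋-by-coeff p≗f q≗g f≗g = coeffwise λ i → trans (p≗f i) (trans (f≗g i) (sym (q≗g i)))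

∷-cong : ∀ {a b p q} → a ≡ b → p ≋ q → a ∷ p ≋ b ∷ q
∷-cong a≡b p≋q = coeffwise λ { zero → a≡b ; (suc i) → coeff-≡ p≋q i }

coeff-+ : ∀ p q i → coeff (p +P q) i ≡ coeff p i + coeff q i
coeff-+ []      q       i       = sym (ℤ.+-identityˡ _)
coeff-+ (a ∷ p) []      i       = sym (ℤ.+-identityʳ _)
coeff-+ (a ∷ p) (b ∷ q) zero    = refl
coeff-+ (a ∷ p) (b ∷ q) (suc i) = coeff-+ p q i

coeff-scale : ∀ c p i → coeff (scaleP c p) i ≡ c * coeff p i
coeff-scale c []      i       = sym (ℤ.*-zeroʳ c)
coeff-scale c (a ∷ p) zero    = refl
coeff-scale c (a ∷ p) (suc i) = coeff-scale c p i

+-cong : ∀ {p p′ q q′} → p ≋ p′ → q ≋ q′ → p +P q ≋ p′ +P q′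
+-cong {p} {p′} {q} {q′} p≋p′ q≋q′ =
  ≋-by-coeff (coeff-+ p q) (coeff-+ p′ q′) λ i → cong₂ _+_ (coeff-≡ p≋p′ i) (coeff-≡ q≋q′ i)

+-identityʳ : ∀ p → p +P [] ≋ p
+-identityʳ p = ≋-by-coeff (coeff-+ p []) (λ _ → refl) λ i → ℤ.+-identityʳ (coeff p i)

+-left-comm : ∀ p q r → p +P (q +P r) ≋ q +P (p +P r)
+-left-comm p q r = ≋-by-coeff (coeff-+₃ p q r) (coeff-+₃ q p r) λ i →
  x∙yz≈y∙xz ℤ.+-commutativeSemigroup (coeff p i) (coeff q i) (coeff r i)
  where
  coeff-+₃ : ∀ p q r i → coeff (p +P (q +P r)) i ≡ coeff p i + (coeff q i + coeff r i)
  coeff-+₃ p q r i = trans (coeff-+ p (q +P r) i) (cong (_+_ (coeff p i)) (coeff-+ q r i))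

+-interchange : ∀ p q r s → (p +P q) +P (r +P s) ≋ (p +P r) +P (q +P s)
+-interchange p q r s = ≋-by-coeff (coeff-+₂₂ p q r s) (coeff-+₂₂ p r q s) λ i →
  interchange ℤ.+-commutativeSemigroup (coeff p i) (coeff q i) (coeff r i) (coeff s i)
  where
  coeff-+₂₂ : ∀ p q r s i →
    coeff ((p +P q) +P (r +P s)) i ≡ (coeff p i + coeff q i) + (coeff r i + coeff s i)
  coeff-+₂₂ p q r s i =
    trans (coeff-+ (p +P q) (r +P s) i) (cong₂ _+_ (coeff-+ p q i) (coeff-+ r s i))

scale-cong : ∀ c {p q} → p ≋ q → scaleP c p ≋ scaleP c q
scale-cong c {p} {q} p≋q =
  ≋-by-coeff (coeff-scale c p) (coeff-scale c q) λ i → cong (c *_) (coeff-≡ p≋q i)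

scale-zeroˡ : ∀ p → scaleP 0ℤ p ≋ []
scale-zeroˡ p = ≋-by-coeff (coeff-scale 0ℤ p) (λ _ → refl) λ i → ℤ.*-zeroˡ (coeff p i)

scale-distribˡ : ∀ c p q → scaleP c (p +P q) ≋ scaleP c p +P scaleP c q
scale-distribˡ c p q =
  ≋-by-coeff (λ i → trans (coeff-scale c (p +P q) i) (cong (c *_) (coeff-+ p q i)))
             (λ i → trans (coeff-+ (scaleP c p) (scaleP c q) i)
                          (cong₂ _+_ (coeff-scale c p i) (coeff-scale c q i)))
             λ i → ℤ.*-distribˡ-+ c (coeff p i) (coeff q i)

scale-distribʳ : ∀ a b p → scaleP (a + b) p ≋ scaleP a p +P scaleP b p
scale-distribʳ a b p =
  ≋-by-coeff (coeff-scale (a + b) p)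
             (λ i → trans (coeff-+ (scaleP a p) (scaleP b p) i)
                          (cong₂ _+_ (coeff-scale a p i) (coeff-scale b p i)))
             λ i → ℤ.*-distribʳ-+ (coeff p i) a b

scale-scale : ∀ c a p → scaleP c (scaleP a p) ≋ scaleP (c * a) p
scale-scale c a p =
  ≋-by-coeff (λ i → trans (coeff-scale c (scaleP a p) i) (cong (c *_) (coeff-scale a p i)))
             (coeff-scale (c * a) p)
             λ i → sym (ℤ.*-assoc c a (coeff p i))

*-zeroʳ : ∀ p → p *P [] ≋ []
*-zeroʳ []      = ≋-refl
*-zeroʳ (a ∷ p) = coeffwise λ { zero → refl ; (suc i) → coeff-≡ (*-zeroʳ p) i }

*-identityˡ : ∀ p → (1ℤ ∷ []) *P p ≋ p
*-identityˡ p = ≋-by-coeff (λ i → trans (coeff-+ (scaleP 1ℤ p) (0ℤ ∷ []) i)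
                                        (cong₂ _+_ (coeff-scale 1ℤ p i) (coeff-0∷[] i)))
                           (λ _ → refl)
                           λ i → trans (ℤ.+-identityʳ _) (ℤ.*-identityˡ (coeff p i))
  where
  coeff-0∷[] : ∀ i → coeff (0ℤ ∷ []) i ≡ 0ℤ
  coeff-0∷[] zero    = refl
  coeff-0∷[] (suc i) = refl

*-identityʳ : ∀ p → p *P (1ℤ ∷ []) ≋ p
*-identityʳ []      = ≋-refl
*-identityʳ (a ∷ p) = ∷-cong (trans (ℤ.+-identityʳ _) (ℤ.*-identityʳ a)) (*-identityʳ p)

*-congʳ : ∀ p {q q′} → q ≋ q′ → p *P q ≋ p *P q′
*-congʳ []      q≋q′ = ≋-refl
*-congʳ (a ∷ p) q≋q′ = +-cong (scale-cong a q≋q′) (∷-cong refl (*-congʳ p q≋q′))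

*-distribˡ : ∀ p q r → p *P (q +P r) ≋ p *P q +P p *P r
*-distribˡ []      q r = ≋-refl
*-distribˡ (a ∷ p) q r = begin
  scaleP a (q +P r) +P (0ℤ ∷ p *P (q +P r))
    ≈⟨ +-cong (scale-distribˡ a q r) (∷-cong refl (*-distribˡ p q r)) ⟩
  (scaleP a q +P scaleP a r) +P ((0ℤ ∷ p *P q) +P (0ℤ ∷ p *P r))
    ≈⟨ +-interchange (scaleP a q) (scaleP a r) (0ℤ ∷ p *P q) (0ℤ ∷ p *P r) ⟩
  (scaleP a q +P (0ℤ ∷ p *P q)) +P (scaleP a r +P (0ℤ ∷ p *P r)) ∎
  where open ≋-Reasoning

*-distribʳ : ∀ p p′ q → (p +P p′) *P q ≋ p *P q +P p′ *P q
*-distribʳ []      p′       q = ≋-refl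
*-distribʳ (a ∷ p) []       q = ≋-sym (+-identityʳ ((a ∷ p) *P q))
*-distribʳ (a ∷ p) (b ∷ p′) q = begin
  scaleP (a + b) q +P (0ℤ ∷ (p +P p′) *P q)
    ≈⟨ +-cong (scale-distribʳ a b q) (∷-cong refl (*-distribʳ p p′ q)) ⟩
  (scaleP a q +P scaleP b q) +P ((0ℤ ∷ p *P q) +P (0ℤ ∷ p′ *P q))
    ≈⟨ +-interchange (scaleP a q) (scaleP b q) (0ℤ ∷ p *P q) (0ℤ ∷ p′ *P q) ⟩
  (scaleP a q +P (0ℤ ∷ p *P q)) +P (scaleP b q +P (0ℤ ∷ p′ *P q)) ∎
  where open ≋-Reasoning

0∷-* : ∀ p q → (0ℤ ∷ p) *P q ≋ 0ℤ ∷ p *P q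
0∷-* p q = +-cong (scale-zeroˡ q) ≋-refl

scale-* : ∀ c p q → scaleP c (p *P q) ≋ scaleP c p *P q
scale-* c []      q = ≋-refl
scale-* c (a ∷ p) q = ≋-trans (scale-distribˡ c (scaleP a q) (0ℤ ∷ p *P q))
  (+-cong (scale-scale c a q) (∷-cong (ℤ.*-zeroʳ c) (scale-* c p q)))

*-assoc : ∀ p q r → (p *P q) *P r ≋ p *P (q *P r)
*-assoc []      q r = ≋-refl
*-assoc (a ∷ p) q r = begin
  (scaleP a q +P (0ℤ ∷ p *P q)) *P r
    ≈⟨ *-distribʳ (scaleP a q) (0ℤ ∷ p *P q) r ⟩
  scaleP a q *P r +P (0ℤ ∷ p *P q) *P r
    ≈⟨ +-cong (≋-sym (scale-* a q r)) (0∷-* (p *P q) r) ⟩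
  scaleP a (q *P r) +P (0ℤ ∷ (p *P q) *P r)
    ≈⟨ +-cong ≋-refl (∷-cong refl (*-assoc p q r)) ⟩
  scaleP a (q *P r) +P (0ℤ ∷ p *P (q *P r)) ∎
  where open ≋-Reasoning

*-∷ : ∀ p b q → p *P (b ∷ q) ≋ scaleP b p +P (0ℤ ∷ p *P q)
*-∷ []      b q = coeffwise λ { zero → refl ; (suc i) → refl }
*-∷ (a ∷ p) b q = ∷-cong (cong (_+ 0ℤ) (ℤ.*-comm a b)) (begin
  scaleP a q +P p *P (b ∷ q)                 ≈⟨ +-cong ≋-refl (*-∷ p b q) ⟩
  scaleP a q +P (scaleP b p +P (0ℤ ∷ p *P q)) ≈⟨ +-left-comm (scaleP a q) (scaleP b p) _ ⟩
  scaleP b p +P (scaleP a q +P (0ℤ ∷ p *P q)) ∎)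
  where open ≋-Reasoning

*-comm : ∀ p q → p *P q ≋ q *P p
*-comm []      q = ≋-sym (*-zeroʳ q)
*-comm (a ∷ p) q = ≋-trans (+-cong ≋-refl (∷-cong refl (*-comm p q))) (≋-sym (*-∷ q a p))

*-congˡ : ∀ {p p′} q → p ≋ p′ → p *P q ≋ p′ *P q
*-congˡ {p} {p′} q p≋p′ = ≋-trans (*-comm p q) (≋-trans (*-congʳ q p≋p′) (*-comm q p′))

eval-≋[] : ∀ {p} → p ≋ [] → ∀ x → eval p x ≡ 0ℤ
eval-≋[] {[]}    _    x = refl
eval-≋[] {c ∷ p} p≋[] x = begin
  c + x * eval p x ≡⟨ cong₂ (λ c v → c + x * v) (coeff-≡ p≋[] 0) (eval-≋[] p≋[]′ x) ⟩
  0ℤ + x * 0ℤ      ≡⟨ trans (ℤ.+-identityˡ _) (ℤ.*-zeroʳ x) ⟩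
  0ℤ               ∎
  where
  open ≡-Reasoning
  p≋[]′ : p ≋ []
  p≋[]′ = coeffwise λ i → coeff-≡ p≋[] (suc i)

eval-cong : ∀ {p q} → p ≋ q → ∀ x → eval p x ≡ eval q x
eval-cong {[]}    {q}     p≋q x = sym (eval-≋[] (≋-sym p≋q) x)
eval-cong {c ∷ p} {[]}    p≋q x = eval-≋[] p≋q x
eval-cong {c ∷ p} {d ∷ q} p≋q x = cong₂ (λ c v → c + x * v) (coeff-≡ p≋q 0)
  (eval-cong {p} {q} (coeffwise λ i → coeff-≡ p≋q (suc i)) x)

eval-+ : ∀ p q x → eval (p +P q) x ≡ eval p x + eval q x
eval-+ []      q       x = sym (ℤ.+-identityˡ _)
eval-+ (a ∷ p) []      x = sym (ℤ.+-identityʳ _)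
eval-+ (a ∷ p) (b ∷ q) x =
  trans (cong (λ v → (a + b) + x * v) (eval-+ p q x)) (regroup a b x (eval p x) (eval q x))
  where
  regroup : ∀ a b x u v → (a + b) + x * (u + v) ≡ (a + x * u) + (b + x * v)
  regroup = solve-∀

eval-scale : ∀ c p x → eval (scaleP c p) x ≡ c * eval p x
eval-scale c []      x = sym (ℤ.*-zeroʳ c)
eval-scale c (a ∷ p) x =
  trans (cong (λ v → c * a + x * v) (eval-scale c p x)) (regroup c a x (eval p x))
  where
  regroup : ∀ c a x u → c * a + x * (c * u) ≡ c * (a + x * u)
  regroup = solve-∀

eval-* : ∀ p q x → eval (p *P q) x ≡ eval p x * eval q x
eval-* []      q x = refl
eval-* (a ∷ p) q x = begin
  eval (scaleP a q +P (0ℤ ∷ p *P q)) x            ≡⟨ eval-+ (scaleP a q) (0ℤ ∷ p *P q) x ⟩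
  eval (scaleP a q) x + (0ℤ + x * eval (p *P q) x) ≡⟨ cong₂ (λ u v → u + (0ℤ + x * v))
                                                             (eval-scale a q x) (eval-* p q x) ⟩
  a * eval q x + (0ℤ + x * (eval p x * eval q x))  ≡⟨ regroup a x (eval p x) (eval q x) ⟩
  (a + x * eval p x) * eval q x                    ∎
  where
  open ≡-Reasoning
  regroup : ∀ a x u v → a * v + (0ℤ + x * (u * v)) ≡ (a + x * u) * v
  regroup = solve-∀

eval-one : ∀ x → eval (1ℤ ∷ []) x ≡ 1ℤ
eval-one x = trans (cong (_+_ 1ℤ) (ℤ.*-zeroʳ x)) (ℤ.+-identityʳ 1ℤ)

-- The formal derivative and simple roots

deriv : Poly → Poly
deriv []      = []
deriv (a ∷ p) = p +P (0ℤ ∷ deriv p)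

coeff-deriv : ∀ p i → coeff (deriv p) i ≡ + suc i * coeff p (suc i)
coeff-deriv []      i       = sym (ℤ.*-zeroʳ (+ suc i))
coeff-deriv (a ∷ p) zero    = trans (coeff-+ p (0ℤ ∷ deriv p) 0)
  (trans (ℤ.+-identityʳ _) (sym (ℤ.*-identityˡ _)))
coeff-deriv (a ∷ p) (suc i) = trans (coeff-+ p (0ℤ ∷ deriv p) (suc i))
  (trans (cong (_+_ (coeff p (suc i))) (coeff-deriv p i)) (step (+ suc i) (coeff p (suc i))))
  where
  step : ∀ k c → c + k * c ≡ (1ℤ + k) * c
  step = solve-∀

deriv-cong : ∀ {p q} → p ≋ q → deriv p ≋ deriv q
deriv-cong {p} {q} p≋q = ≋-by-coeff (coeff-deriv p) (coeff-deriv q) λ i →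
  cong (+ suc i *_) (coeff-≡ p≋q (suc i))

deriv-+ : ∀ p q → deriv (p +P q) ≋ deriv p +P deriv q
deriv-+ p q =
  ≋-by-coeff (λ i → trans (coeff-deriv (p +P q) i) (cong (+ suc i *_) (coeff-+ p q (suc i))))
             (λ i → trans (coeff-+ (deriv p) (deriv q) i)
                          (cong₂ _+_ (coeff-deriv p i) (coeff-deriv q i)))
             λ i → ℤ.*-distribˡ-+ (+ suc i) (coeff p (suc i)) (coeff q (suc i))

deriv-scale : ∀ c p → deriv (scaleP c p) ≋ scaleP c (deriv p)
deriv-scale c p =
  ≋-by-coeff (λ i → trans (coeff-deriv (scaleP c p) i)
                          (cong (+ suc i *_) (coeff-scale c p (suc i))))
             (λ i → trans (coeff-scale c (deriv p) i) (cong (c *_) (coeff-deriv p i)))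
             λ i → x∙yz≈y∙xz ℤ.*-commutativeSemigroup (+ suc i) c (coeff p (suc i))

eval-deriv-cong : ∀ {p q} → p ≋ q → ∀ x → eval (deriv p) x ≡ eval (deriv q) x
eval-deriv-cong p≋q = eval-cong (deriv-cong p≋q)

eval-deriv-∷ : ∀ a p x → eval (deriv (a ∷ p)) x ≡ eval p x + x * eval (deriv p) x
eval-deriv-∷ a p x =
  trans (eval-+ p (0ℤ ∷ deriv p) x) (cong (_+_ (eval p x)) (ℤ.+-identityˡ _))

eval-deriv-* : ∀ p q x →
  eval (deriv (p *P q)) x ≡ eval (deriv p) x * eval q x + eval p x * eval (deriv q) x
eval-deriv-* []      q x = refl
eval-deriv-* (a ∷ p) q x = begin
  eval (deriv (scaleP a q +P (0ℤ ∷ p *P q))) x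
    ≡⟨ eval-cong (deriv-+ (scaleP a q) (0ℤ ∷ p *P q)) x ⟩
  eval (deriv (scaleP a q) +P deriv (0ℤ ∷ p *P q)) x
    ≡⟨ eval-+ (deriv (scaleP a q)) (deriv (0ℤ ∷ p *P q)) x ⟩
  eval (deriv (scaleP a q)) x + eval (deriv (0ℤ ∷ p *P q)) x
    ≡⟨ cong₂ _+_ (trans (eval-cong (deriv-scale a q) x) (eval-scale a (deriv q) x))
                 (eval-deriv-∷ 0ℤ (p *P q) x) ⟩
  a * DQ + (eval (p *P q) x + x * eval (deriv (p *P q)) x)
    ≡⟨ cong₂ (λ u v → a * DQ + (u + x * v)) (eval-* p q x) (eval-deriv-* p q x) ⟩
  a * DQ + (P * Q + x * (DP * Q + P * DQ))
    ≡⟨ regroup a x P Q DP DQ ⟩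
  (P + x * DP) * Q + (a + x * P) * DQ
    ≡⟨ cong (λ u → u * Q + (a + x * P) * DQ) (eval-deriv-∷ a p x) ⟨
  eval (deriv (a ∷ p)) x * Q + (a + x * P) * DQ ∎
  where
  open ≡-Reasoning
  P = eval p x
  Q = eval q x
  DP = eval (deriv p) x
  DQ = eval (deriv q) x
  regroup : ∀ a x u v s t →
    a * t + (u * v + x * (s * v + u * t)) ≡ (u + x * s) * v + (a + x * u) * t
  regroup = solve-∀

eval-xMinus-root : ∀ r → eval (xMinus r) r ≡ 0ℤ
eval-xMinus-root = identity
  where
  identity : ∀ r → - r + r * (1ℤ + r * 0ℤ) ≡ 0ℤ
  identity = solve-∀

eval-deriv-xMinus : ∀ r x → eval (deriv (xMinus r)) x ≡ 1ℤ
eval-deriv-xMinus r = identity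
  where
  identity : ∀ x → 1ℤ + x * (0ℤ + x * 0ℤ) ≡ 1ℤ
  identity = solve-∀

eval-deriv-xMinus-* : ∀ r p → eval (deriv (xMinus r *P p)) r ≡ eval p r
eval-deriv-xMinus-* r p = begin
  eval (deriv (xMinus r *P p)) r
    ≡⟨ eval-deriv-* (xMinus r) p r ⟩
  eval (deriv (xMinus r)) r * eval p r + eval (xMinus r) r * eval (deriv p) r
    ≡⟨ cong₂ (λ u v → u * eval p r + v * eval (deriv p) r)
             (eval-deriv-xMinus r r) (eval-xMinus-root r) ⟩
  1ℤ * eval p r + 0ℤ * eval (deriv p) r
    ≡⟨ cong₂ _+_ (ℤ.*-identityˡ (eval p r)) (ℤ.*-zeroˡ (eval (deriv p) r)) ⟩
  eval p r + 0ℤ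
    ≡⟨ ℤ.+-identityʳ _ ⟩
  eval p r ∎
  where open ≡-Reasoning

-- The derivative of (x - r) s at r is s(r), while that of (x - r)² q vanishes at r.
simpleRoot-of-factor : ∀ {r g s} → g ≋ xMinus r *P s → eval s r ≢ 0ℤ → SimpleRoot r g
simpleRoot-of-factor {r} {g} {s} g≋ s[r]≢0 = (s , coeff-≡ g≋) , not-double
  where
  L = xMinus r
  not-double : ¬ (L *P L) ∣P g
  not-double (q , g≈) = s[r]≢0 (begin
    eval s r                       ≡⟨ eval-deriv-xMinus-* r s ⟨
    eval (deriv (L *P s)) r        ≡⟨ eval-deriv-cong g≋ r ⟨
    eval (deriv g) r               ≡⟨ eval-deriv-cong g≋L²q r ⟩
    eval (deriv ((L *P L) *P q)) r ≡⟨ eval-deriv-cong (*-assoc L L q) r ⟩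
    eval (deriv (L *P (L *P q))) r ≡⟨ eval-deriv-xMinus-* r (L *P q) ⟩
    eval (L *P q) r                ≡⟨ eval-* L q r ⟩
    eval L r * eval q r            ≡⟨ cong (_* eval q r) (eval-xMinus-root r) ⟩
    0ℤ * eval q r                  ≡⟨ ℤ.*-zeroˡ (eval q r) ⟩
    0ℤ                             ∎)
    where
    open ≡-Reasoning
    g≋L²q : g ≋ (L *P L) *P q
    g≋L²q = coeffwise g≈

-- Linear factors and rising factorials

lin : ℕ → Poly
lin c = + c ∷ 1ℤ ∷ []

xMinus-neg : ∀ c → xMinus (- + c) ≡ lin c
xMinus-neg c = cong (λ a → a ∷ 1ℤ ∷ []) (ℤ.neg-involutive (+ c))

eval-lin : ∀ c x → eval (lin c) x ≡ + c + x
eval-lin c x = identity (+ c) x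
  where
  identity : ∀ c x → c + x * (1ℤ + x * 0ℤ) ≡ c + x
  identity = solve-∀

eval-lin-root : ∀ c → eval (lin c) (- + c) ≡ 0ℤ
eval-lin-root c = trans (eval-lin c (- + c)) (ℤ.+-inverseʳ (+ c))

eval-lin-nonneg : ∀ {c i} → i ≤ c → eval (lin c) (- + i) ≡ + (c ∸ i)
eval-lin-nonneg {c} {i} i≤c =
  trans (eval-lin c (- + i)) (trans (ℤ.m-n≡m⊖n c i) (ℤ.⊖-≥ i≤c))

eval-lin-nonroot : ∀ {c i} → c ≢ i → eval (lin c) (- + i) ≢ 0ℤ
eval-lin-nonroot {c} {i} c≢i lin≡0 =
  c≢i (ℤ.+-injective (ℤ.i-j≡0⇒i≡j (+ c) (+ i) (trans (sym (eval-lin c (- + i))) lin≡0)))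

*-≢0 : ∀ {i j} → i ≢ 0ℤ → j ≢ 0ℤ → i * j ≢ 0ℤ
*-≢0 {i} i≢0 j≢0 ij≡0 = [ i≢0 , j≢0 ]′ (ℤ.i*j≡0⇒i≡0∨j≡0 i ij≡0)

IsNatural : ℤ → Set
IsNatural z = ∃[ m ] z ≡ + m

+-isNatural : ∀ {i j} → IsNatural i → IsNatural j → IsNatural (i + j)
+-isNatural (m , refl) (k , refl) = m ℕ.+ k , refl

*-isNatural : ∀ {i j} → IsNatural i → IsNatural j → IsNatural (i * j)
*-isNatural (m , refl) (k , refl) = m ℕ.* k , sym (ℤ.pos-* m k)

rising : ℕ → ℕ → Poly
rising s zero    = 1ℤ ∷ []
rising s (suc d) = lin (s ℕ.+ d) *P rising s d

coeff-lin-* : ∀ c q j → coeff (lin c *P q) (suc j) ≡ + c * coeff q (suc j) + coeff q j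
coeff-lin-* c q j = trans (coeff-+ (scaleP (+ c) q) (0ℤ ∷ (1ℤ ∷ []) *P q) (suc j))
  (cong₂ _+_ (coeff-scale (+ c) q (suc j)) (coeff-≡ (*-identityˡ q) j))

rising-coeff-above : ∀ s {d i} → d < i → coeff (rising s d) i ≡ 0ℤ
rising-coeff-above s {zero}  {suc i} _          = refl
rising-coeff-above s {suc d} {suc i} (s≤s d<i) = begin
  coeff (lin (s ℕ.+ d) *P rising s d) (suc i)
    ≡⟨ coeff-lin-* (s ℕ.+ d) (rising s d) i ⟩
  + (s ℕ.+ d) * coeff (rising s d) (suc i) + coeff (rising s d) i
    ≡⟨ cong₂ (λ u v → + (s ℕ.+ d) * u + v)
             (rising-coeff-above s (ℕ.m<n⇒m<1+n d<i)) (rising-coeff-above s d<i) ⟩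
  + (s ℕ.+ d) * 0ℤ + 0ℤ
    ≡⟨ trans (ℤ.+-identityʳ _) (ℤ.*-zeroʳ (+ (s ℕ.+ d))) ⟩
  0ℤ ∎
  where open ≡-Reasoning

rising-coeff-top : ∀ s d → coeff (rising s d) d ≡ 1ℤ
rising-coeff-top s zero    = refl
rising-coeff-top s (suc d) = begin
  coeff (lin (s ℕ.+ d) *P rising s d) (suc d)
    ≡⟨ coeff-lin-* (s ℕ.+ d) (rising s d) d ⟩
  + (s ℕ.+ d) * coeff (rising s d) (suc d) + coeff (rising s d) d
    ≡⟨ cong₂ (λ u v → + (s ℕ.+ d) * u + v)
             (rising-coeff-above s (ℕ.n<1+n d)) (rising-coeff-top s d) ⟩
  + (s ℕ.+ d) * 0ℤ + 1ℤ
    ≡⟨ cong (_+ 1ℤ) (ℤ.*-zeroʳ (+ (s ℕ.+ d))) ⟩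
  1ℤ ∎
  where open ≡-Reasoning

eval-rising-isNatural : ∀ {s i} d → i ≤ s → IsNatural (eval (rising s d) (- + i))
eval-rising-isNatural {i = i} zero    _   = 1 , eval-one (- + i)
eval-rising-isNatural {s} {i} (suc d) i≤s =
  subst IsNatural (sym (eval-* (lin (s ℕ.+ d)) (rising s d) (- + i)))
    (*-isNatural (s ℕ.+ d ∸ i , eval-lin-nonneg (ℕ.≤-trans i≤s (ℕ.m≤m+n s d)))
                 (eval-rising-isNatural d i≤s))

eval-rising-root : ∀ {s i} d → s ≤ i → i < s ℕ.+ d → eval (rising s d) (- + i) ≡ 0ℤ
eval-rising-root {s} zero s≤i i<s+0 =
  contradiction s≤i (ℕ.<⇒≱ (subst (_ <_) (ℕ.+-identityʳ s) i<s+0))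
eval-rising-root {s} {i} (suc d) s≤i i<s+1+d
  with ℕ.m≤n⇒m<n∨m≡n (ℕ.≤-pred (subst (i <_) (ℕ.+-suc s d) i<s+1+d))
... | inj₁ i<s+d = trans (eval-* (lin (s ℕ.+ d)) (rising s d) (- + i))
  (trans (cong (eval (lin (s ℕ.+ d)) (- + i) *_) (eval-rising-root d s≤i i<s+d))
  (ℤ.*-zeroʳ (eval (lin (s ℕ.+ d)) (- + i))))
... | inj₂ refl   = trans (eval-* (lin (s ℕ.+ d)) (rising s d) (- + i))
  (trans (cong (_* eval (rising s d) (- + i)) (eval-lin-root (s ℕ.+ d)))
  (ℤ.*-zeroˡ (eval (rising s d) (- + i))))

pP-*-rising : ∀ a d → pP a *P rising (suc a) d ≋ pP (a ℕ.+ d)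
pP-*-rising a zero    rewrite ℕ.+-identityʳ a = *-identityʳ (pP a)
pP-*-rising a (suc d) rewrite ℕ.+-suc a d     = begin
  pP a *P (lin (suc a ℕ.+ d) *P rising (suc a) d)
    ≈⟨ *-congʳ (pP a) (*-comm (lin (suc a ℕ.+ d)) (rising (suc a) d)) ⟩
  pP a *P (rising (suc a) d *P lin (suc a ℕ.+ d))
    ≈⟨ *-assoc (pP a) (rising (suc a) d) (lin (suc a ℕ.+ d)) ⟨
  (pP a *P rising (suc a) d) *P lin (suc a ℕ.+ d)
    ≈⟨ *-congˡ (lin (suc a ℕ.+ d)) (pP-*-rising a d) ⟩
  pP (a ℕ.+ d) *P lin (suc (a ℕ.+ d)) ∎
  where open ≋-Reasoning

-- p_b / p_a = (x + a + 1) ⋯ (x + b) when a ≤ b; the constant 1 when b < a (truncated ∸).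
cofactor : ℕ → ℕ → Poly
cofactor a b = rising (suc a) (b ∸ a)

pP-*-cofactor : ∀ {a b} → a ≤ b → pP a *P cofactor a b ≋ pP b
pP-*-cofactor {a} {b} a≤b =
  subst (λ m → pP a *P cofactor a b ≋ pP m) (ℕ.m+[n∸m]≡n a≤b) (pP-*-rising a (b ∸ a))

cofactor-root : ∀ {a b i} → a < i → i ≤ b → eval (cofactor a b) (- + i) ≡ 0ℤ
cofactor-root {a} {b} {i} a<i i≤b = eval-rising-root (b ∸ a) a<i
  (subst (λ m → i < suc m) (sym (ℕ.m+[n∸m]≡n (ℕ.<⇒≤ (ℕ.<-≤-trans a<i i≤b)))) (s≤s i≤b))

cofactor-isNatural : ∀ {a i} b → i ≤ a → IsNatural (eval (cofactor a b) (- + i))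
cofactor-isNatural {a} b i≤a = eval-rising-isNatural (b ∸ a) (ℕ.m≤n⇒m≤1+n i≤a)

coeff-sumP-zero : ∀ {ps} i → All (λ p → coeff p i ≡ 0ℤ) ps → coeff (sumP ps) i ≡ 0ℤ
coeff-sumP-zero          i []           = refl
coeff-sumP-zero {p ∷ ps} i (p≡0 ∷ ps≡0) =
  trans (coeff-+ p (sumP ps) i) (cong₂ _+_ p≡0 (coeff-sumP-zero i ps≡0))

eval-sumP-zero : ∀ {ps} x → All (λ p → eval p x ≡ 0ℤ) ps → eval (sumP ps) x ≡ 0ℤ
eval-sumP-zero          x []           = refl
eval-sumP-zero {p ∷ ps} x (p≡0 ∷ ps≡0) =
  trans (eval-+ p (sumP ps) x) (cong₂ _+_ p≡0 (eval-sumP-zero x ps≡0))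

eval-sumP-isNatural : ∀ {ps} x →
  All (λ p → IsNatural (eval p x)) ps → IsNatural (eval (sumP ps) x)
eval-sumP-isNatural          x []           = 0 , refl
eval-sumP-isNatural {p ∷ ps} x (p∈ℕ ∷ ps∈ℕ) =
  subst IsNatural (sym (eval-+ p (sumP ps) x)) (+-isNatural p∈ℕ (eval-sumP-isNatural x ps∈ℕ))

pP-*-sumP-cofactor : ∀ {a bs} → All (a ≤_) bs →
  pP a *P sumP (map (cofactor a) bs) ≋ sumP (map pP bs)
pP-*-sumP-cofactor {a} {[]}     []           = *-zeroʳ (pP a)
pP-*-sumP-cofactor {a} {b ∷ bs} (a≤b ∷ a≤bs) =
  ≋-trans (*-distribˡ (pP a) (cofactor a b) (sumP (map (cofactor a) bs)))
          (+-cong (pP-*-cofactor a≤b) (pP-*-sumP-cofactor a≤bs))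

-- The cofactor h_T = g_T / p_a

hT : ℕ → ℕ → List ℕ → Poly
hT n a rest = (1ℤ ∷ []) +P (cofactor a n +P sumP (map (cofactor a) rest))

gT-factor : ∀ {n a rest} → a ≤ n → All (a ≤_) rest → gT n (a ∷ rest) ≋ pP a *P hT n a rest
gT-factor {n} {a} {rest} a≤n a≤rest = ≋-sym (begin
  pP a *P ((1ℤ ∷ []) +P (cofactor a n +P S))
    ≈⟨ *-distribˡ (pP a) (1ℤ ∷ []) (cofactor a n +P S) ⟩
  pP a *P (1ℤ ∷ []) +P pP a *P (cofactor a n +P S)
    ≈⟨ +-cong (*-identityʳ (pP a)) (*-distribˡ (pP a) (cofactor a n) S) ⟩
  pP a +P (pP a *P cofactor a n +P pP a *P S)
    ≈⟨ +-cong (≋-refl {pP a}) (+-cong (pP-*-cofactor a≤n) (pP-*-sumP-cofactor a≤rest)) ⟩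
  pP a +P (pP n +P sumP (map pP rest))
    ≈⟨ +-left-comm (pP a) (pP n) (sumP (map pP rest)) ⟩
  pP n +P (pP a +P sumP (map pP rest)) ∎)
  where
  open ≋-Reasoning
  S = sumP (map (cofactor a) rest)

coeff-hT : ∀ n a rest i → coeff (hT n a rest) i ≡
  coeff (1ℤ ∷ []) i + (coeff (cofactor a n) i + coeff (sumP (map (cofactor a) rest)) i)
coeff-hT n a rest i = trans (coeff-+ (1ℤ ∷ []) (cofactor a n +P sumP (map (cofactor a) rest)) i)
  (cong (_+_ (coeff (1ℤ ∷ []) i)) (coeff-+ (cofactor a n) (sumP (map (cofactor a) rest)) i))

hT-degree : ∀ {n a rest} → a < n → All (λ b → a ≤ b × b < n) rest →
  HasDegree (hT n a rest) (n ∸ a)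
hT-degree {n} {a} {rest} a<n bounds = top≢0 , above
  where
  d = n ∸ a
  one-above : ∀ {i} → 0 < i → coeff (1ℤ ∷ []) i ≡ 0ℤ
  one-above {suc i} _ = refl
  rest-above : ∀ {i} → d ≤ i → coeff (sumP (map (cofactor a) rest)) i ≡ 0ℤ
  rest-above {i} d≤i = coeff-sumP-zero i (All.map⁺ (All.map
    (λ (a≤b , b<n) → rising-coeff-above (suc a) (ℕ.<-≤-trans (ℕ.∸-monoˡ-< b<n a≤b) d≤i)) bounds))
  top≡1 : coeff (hT n a rest) d ≡ 1ℤ
  top≡1 = trans (coeff-hT n a rest d) (cong₂ _+_ (one-above (ℕ.m<n⇒0<n∸m a<n))
    (cong₂ _+_ (rising-coeff-top (suc a) d) (rest-above ℕ.≤-refl)))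
  top≢0 : coeff (hT n a rest) d ≢ 0ℤ
  top≢0 top≡0 = case trans (sym top≡1) top≡0 of λ ()
  above : ∀ i → d < i → coeff (hT n a rest) i ≡ 0ℤ
  above i d<i = trans (coeff-hT n a rest i) (cong₂ _+_ (one-above (ℕ.<-trans (ℕ.m<n⇒0<n∸m a<n) d<i))
    (cong₂ _+_ (rising-coeff-above (suc a) d<i) (rest-above (ℕ.<⇒≤ d<i))))

eval-hT : ∀ n a rest x → eval (hT n a rest) x ≡
  1ℤ + (eval (cofactor a n) x + eval (sumP (map (cofactor a) rest)) x)
eval-hT n a rest x = trans (eval-+ (1ℤ ∷ []) (cofactor a n +P sumP (map (cofactor a) rest)) x)
  (cong₂ _+_ (eval-one x) (eval-+ (cofactor a n) (sumP (map (cofactor a) rest)) x))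

hT-nonroot : ∀ {a i} n rest → i ≤ a → eval (hT n a rest) (- + i) ≢ 0ℤ
hT-nonroot {a} {i} n rest i≤a hT≡0 = case trans (sym hT≡1+m) hT≡0 of λ ()
  where
  rest∈ℕ : All (λ p → IsNatural (eval p (- + i))) (map (cofactor a) rest)
  rest∈ℕ = All.map⁺ (All.universal (λ b → cofactor-isNatural b i≤a) rest)
  m∈ℕ = +-isNatural (cofactor-isNatural n i≤a) (eval-sumP-isNatural (- + i) rest∈ℕ)
  hT≡1+m : eval (hT n a rest) (- + i) ≡ + suc (proj₁ m∈ℕ)
  hT≡1+m = trans (eval-hT n a rest (- + i)) (cong (_+_ 1ℤ) (proj₂ m∈ℕ))

pP-nonroot : ∀ {a m} → a < m → eval (pP a) (- + m) ≢ 0ℤ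
pP-nonroot {zero}  {m} 0<m = eval-lin-nonroot (ℕ.<⇒≢ 0<m)
pP-nonroot {suc a} {m} a<m pP≡0 =
  *-≢0 (pP-nonroot (ℕ.<-trans (ℕ.n<1+n a) a<m)) (eval-lin-nonroot (ℕ.<⇒≢ a<m))
  (trans (sym (eval-* (pP a) (lin (suc a)) (- + m))) pP≡0)

pP-root-factor : ∀ {a i} → i ≤ a → ∃[ s ] pP a ≋ lin i *P s × eval s (- + i) ≢ 0ℤ
pP-root-factor {zero} z≤n = 1ℤ ∷ [] , ≋-sym (*-identityʳ (lin 0)) , λ ()
pP-root-factor {suc a} {i} i≤1+a with ℕ.m≤n⇒m<n∨m≡n i≤1+a
... | inj₂ refl = pP a , *-comm (pP a) (lin (suc a)) , pP-nonroot (ℕ.n<1+n a)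
... | inj₁ (s≤s i≤a) with pP-root-factor i≤a
...   | s , pP≋ , s≢0 =
  s *P lin (suc a) ,
  ≋-trans (*-congˡ (lin (suc a)) pP≋) (*-assoc (lin i) s (lin (suc a))) ,
  λ s*lin≡0 → *-≢0 s≢0 (eval-lin-nonroot (ℕ.<⇒≢ (s≤s i≤a) ∘ sym))
    (trans (sym (eval-* s (lin (suc a)) (- + i))) s*lin≡0)

pP-*-simpleRoot : ∀ {a i h g} → i ≤ a → eval h (- + i) ≢ 0ℤ → g ≋ pP a *P h →
  SimpleRoot (- + i) g
pP-*-simpleRoot {a} {i} {h} {g} i≤a h≢0 g≋ with pP-root-factor i≤a
... | s , pP≋ , s≢0 = simpleRoot-of-factor { - + i} {g} {s *P h} g≋x+i*sh
  (λ sh≡0 → *-≢0 s≢0 h≢0 (trans (sym (eval-* s h (- + i))) sh≡0))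
  where
  open ≋-Reasoning
  g≋x+i*sh : g ≋ xMinus (- + i) *P (s *P h)
  g≋x+i*sh = begin
    g                           ≈⟨ g≋ ⟩
    pP a *P h                   ≈⟨ *-congˡ h pP≋ ⟩
    (lin i *P s) *P h           ≈⟨ *-assoc (lin i) s h ⟩
    lin i *P (s *P h)           ≡⟨ cong (_*P (s *P h)) (xMinus-neg i) ⟨
    xMinus (- + i) *P (s *P h)  ∎

-- Parity and squares

2∣m*[m+1] : ∀ m → 2 ℕ.∣ m ℕ.* (m ℕ.+ 1)
2∣m*[m+1] zero    = 2 ℕ.∣0
2∣m*[m+1] (suc m) =
  subst (2 ℕ.∣_) (step m) (ℕ.∣m∣n⇒∣m+n (2∣m*[m+1] m) (ℕ.m∣m*n (m ℕ.+ 1)))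
  where
  step : ∀ m → m ℕ.* (m ℕ.+ 1) ℕ.+ 2 ℕ.* (m ℕ.+ 1) ≡ suc m ℕ.* (suc m ℕ.+ 1)
  step = ℕ-Solver.solve-∀

2∣x*[x+1] : ∀ x → + 2 ∣ x * (x + 1ℤ)
2∣x*[x+1] (+ m)    = ∣ᵤ⇒∣ (subst (2 ℕ.∣_) (sym (ℤ.abs-* (+ m) (+ m + 1ℤ))) (2∣m*[m+1] m))
2∣x*[x+1] -[1+ m ] = subst (+ 2 ∣_) (swap (+ m)) (2∣x*[x+1] (+ m))
  where
  swap : ∀ y → y * (y + 1ℤ) ≡ - (1ℤ + y) * (- (1ℤ + y) + 1ℤ)
  swap = solve-∀

pP-even : ∀ a x → + 2 ∣ eval (pP (suc a)) x
pP-even zero    x =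
  subst (+ 2 ∣_) (sym (trans (eval-* (pP 0) (lin 1) x) (identity x))) (2∣x*[x+1] x)
  where
  identity : ∀ x → (0ℤ + x * (1ℤ + x * 0ℤ)) * (1ℤ + x * (1ℤ + x * 0ℤ)) ≡ x * (x + 1ℤ)
  identity = solve-∀
pP-even (suc a) x = subst (+ 2 ∣_) (sym (eval-* (pP (suc a)) (lin (suc (suc a))) x))
  (∣m⇒∣m*n (eval (lin (suc (suc a))) x) (pP-even a x))

eval-pP-*-even : ∀ {a} h x → 1 ≤ a → + 2 ∣ eval (pP a *P h) x
eval-pP-*-even {suc a} h x _ =
  subst (+ 2 ∣_) (sym (eval-* (pP (suc a)) h x)) (∣m⇒∣m*n (eval h x) (pP-even a x))

2∣⇒≢±1 : ∀ {z} → + 2 ∣ z → z ≢ 1ℤ × z ≢ - 1ℤ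
2∣⇒≢±1 {z} 2∣z = 2∤∣z∣≡1 ∘ cong ℤ.∣_∣ , 2∤∣z∣≡1 ∘ cong ℤ.∣_∣
  where
  2∤∣z∣≡1 : ℤ.∣ z ∣ ≢ 1
  2∤∣z∣≡1 ∣z∣≡1 = case ℕ.∣1⇒≡1 (subst (2 ℕ.∣_) ∣z∣≡1 (∣⇒∣ᵤ 2∣z)) of λ ()

square≢3 : ∀ y → y * y ≢ + 3
square≢3 y y²≡3 = m²≢3 ℤ.∣ y ∣ (trans (sym (ℤ.abs-* y y)) (cong ℤ.∣_∣ y²≡3))
  where
  m²≢3 : ∀ m → m ℕ.* m ≢ 3
  m²≢3 0             ()
  m²≢3 1             ()
  m²≢3 (suc (suc k)) m²≡3 =
    case subst (4 ≤_) m²≡3 (ℕ.*-mono-≤ 2≤2+k 2≤2+k) of λ { (s≤s (s≤s (s≤s ()))) }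
    where
    2≤2+k : 2 ≤ suc (suc k)
    2≤2+k = s≤s (s≤s z≤n)

eval≡3⇒¬IsSquare : ∀ {h} x → eval h x ≡ + 3 → ¬ IsSquare h
eval≡3⇒¬IsSquare {h} x h≡3 (q , h≈q²) = square≢3 (eval q x)
  (trans (sym (eval-* q q x)) (trans (sym (eval-cong {h} {q *P q} (coeffwise h≈q²) x)) h≡3))

hT-not-square : ∀ {n bs} → 4 ≤ n → All (4 ≤_) bs → ¬ IsSquare (hT n 1 (3 ∷ bs))
hT-not-square {n} {bs} 4≤n 4≤bs = eval≡3⇒¬IsSquare {hT n 1 (3 ∷ bs)} (- + 4) (begin
  eval (hT n 1 (3 ∷ bs)) (- + 4)
    ≡⟨ eval-hT n 1 (3 ∷ bs) (- + 4) ⟩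
  1ℤ + (eval (cofactor 1 n) (- + 4) + eval (cofactor 1 3 +P sumP (map (cofactor 1) bs)) (- + 4))
    ≡⟨ cong₂ (λ u v → 1ℤ + (u + v))
             (cofactor-root 1<4 4≤n) (eval-+ (cofactor 1 3) (sumP (map (cofactor 1) bs)) (- + 4)) ⟩
  1ℤ + (0ℤ + (+ 2 + eval (sumP (map (cofactor 1) bs)) (- + 4)))
    ≡⟨ cong (λ v → 1ℤ + (0ℤ + (+ 2 + v)))
            (eval-sumP-zero (- + 4) (All.map⁺ (All.map (cofactor-root 1<4) 4≤bs))) ⟩
  + 3 ∎)
  where
  open ≡-Reasoning
  1<4 : 1 < 4
  1<4 = s≤s (s≤s z≤n)

head<tail : ∀ {a bs} → Linked _<_ (a ∷ bs) → All (a <_) bs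
head<tail sorted with Linked⇒AllPairs ℕ.<-trans sorted
... | a<bs ∷ _ = a<bs

-- 2 ≤ n follows from 1 ≤ a₁ < n, and part (3) needs only a₃ ≥ 4, which 3 < a₃ already gives.
lemma2p3 : (n : ℕ) → 2 ≤ n → (a₁ : ℕ) → (rest : List ℕ) →
    Linked _<_ (a₁ ∷ rest) → All (λ a → 1 ≤ a × a < n) (a₁ ∷ rest) →
    Σ Poly (λ h →
        (gT n (a₁ ∷ rest) ≈P (pP a₁ *P h))
      × HasDegree h (n ∸ a₁)
      × ((a₃ : ℕ) → (rest' : List ℕ) → 5 ≤ n → a₁ ≡ 1 → rest ≡ 3 ∷ a₃ ∷ rest' → 5 ≤ a₃ →
          ¬ IsSquare h))
    × ((i : ℕ) → i ≤ a₁ → SimpleRoot (- (+ i)) (gT n (a₁ ∷ rest)))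
    × ((x : ℤ) → ¬ eval (gT n (a₁ ∷ rest)) x ≡ 1ℤ × ¬ eval (gT n (a₁ ∷ rest)) x ≡ - 1ℤ)
lemma2p3 n _ a rest sorted ((1≤a , a<n) ∷ rest<n) =
    (hT n a rest , coeff-≡ g≋
                 , hT-degree a<n (All.zip (All.map ℕ.<⇒≤ a<rest , All.map proj₂ rest<n))
                 , not-square)
  , (λ i i≤a → pP-*-simpleRoot i≤a (hT-nonroot n rest i≤a) g≋)
  , (λ x → 2∣⇒≢±1 (subst (+ 2 ∣_) (sym (eval-cong g≋ x)) (eval-pP-*-even (hT n a rest) x 1≤a)))
  where
  a<rest : All (a <_) rest
  a<rest = head<tail sorted
  g≋ : gT n (a ∷ rest) ≋ pP a *P hT n a rest
  g≋ = gT-factor (ℕ.<⇒≤ a<n) (All.map ℕ.<⇒≤ a<rest)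
  not-square : ∀ a₃ rest′ → 5 ≤ n → a ≡ 1 → rest ≡ 3 ∷ a₃ ∷ rest′ → 5 ≤ a₃ →
    ¬ IsSquare (hT n a rest)
  not-square a₃ rest′ 5≤n a≡1 rest≡ _ =
    subst₂ (λ a rest → Linked _<_ (a ∷ rest) → ¬ IsSquare (hT n a rest)) (sym a≡1) (sym rest≡)
      (λ { (_ ∷ sorted′) → hT-not-square (ℕ.<⇒≤ 5≤n) (head<tail sorted′) }) sorted
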